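{- For $n\ge1$, let $L_n(q)=\sum_Hq^{|H|}$ where $H$ runs over all alternating heaps over the $n$-point path. Then $(1-q^n)L_n(q)$ is a polynomial in $q$; consequently the sequence of coefficients of $L_n(q)$ is ultimately periodic, with period dividing $n$.
   Context: A heap over the $n$-point path is an equivalence class of finite words on $\{1,\dots,n\}$ under the equivalence generated by exchanging adjacent letters $i,j$ with $|i-j|\ge2$; its size $|H|$ is the length of a representative. It is alternating if for each $i\in\{1,\dots,n-1\}$, in a (equivalently any) representative, the occurrences of letters $i$ and $i+1$ alternate. -}

module Defs where

open import Data.Nat using (ℕ; zero; suc; _+_; _≤_; _<_)
open import Data.Nat.Properties using (_≟_)
open import Data.Fin using (Fin; toℕ)
open import Data.List using (List; []; _∷_; _++_; length)
open import Data.List.Relation.Unary.All using (All)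
open import Data.List.Relation.Unary.Any using (Any)
open import Data.List.Relation.Unary.AllPairs using (AllPairs)
open import Data.List.Relation.Unary.Linked using (Linked)
open import Data.Product using (_×_; Σ)
open import Data.Sum using (_⊎_)
open import Relation.Nullary using (¬_; yes; no)
open import Relation.Binary.PropositionalEquality using (_≡_; _≢_)
open import Relation.Binary.Construct.Closure.ReflexiveTransitive using (Star)

-- Letters 1..n of the paper are represented by Fin n (values 0..n-1);
-- the condition |i - j| ≥ 2 is unchanged by this shift.
Word : ℕ → Set
Word n = List (Fin n)

Far : ∀ {n} → Fin n → Fin n → Set
Far a b = (suc (suc (toℕ a)) ≤ toℕ b) ⊎ (suc (suc (toℕ b)) ≤ toℕ a)

data Swap {n : ℕ} : Word n → Word n → Set where
  swap : (xs ys : Word n) (a b : Fin n) → Far a b →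
         Swap (xs ++ (a ∷ b ∷ ys)) (xs ++ (b ∷ a ∷ ys))

-- the equivalence generated by exchanges (Swap is symmetric, so the
-- reflexive-transitive closure is already the generated equivalence)
_∼_ : ∀ {n} → Word n → Word n → Set
_∼_ = Star Swap

proj : ∀ {n} → ℕ → Word n → List ℕ
proj i [] = []
proj i (x ∷ w) with toℕ x ≟ i | toℕ x ≟ suc i
... | yes _ | _     = toℕ x ∷ proj i w
... | no _  | yes _ = toℕ x ∷ proj i w
... | no _  | no _  = proj i w

Alternating : ∀ {n} → Word n → Set
Alternating {n} w = (i : ℕ) → suc i < n → Linked _≢_ (proj i w)

-- hs is a complete, irredundant list of representatives of the
-- alternating heaps of size k over the n-point path
IsHeapEnum : (n k : ℕ) → List (Word n) → Set
IsHeapEnum n k hs =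
  All (λ h → length h ≡ k × Alternating h) hs ×
  AllPairs (λ u v → ¬ (u ∼ v)) hs ×
  ((w : Word n) → length w ≡ k → Alternating w → Any (λ h → w ∼ h) hs)

-- A heap is determined by its projections onto the edges {i, i+1} of the path, and it is
-- alternating when every projection alternates between i and i+1. Along an alternating heap the
-- numbers of occurrences of neighbouring letters differ by at most one, so a heap of size > n²
-- uses every letter. For such a heap w, prepending the word of first occurrences of its letters
-- repeats the opening block (i,i+1 or i+1,i) of every projection; this is a bijection onto the
-- alternating heaps of size |w| + n, inverted by peeling the first occurrences off again. Hence the
-- number of alternating heaps of size k is periodic in k with period n once k > n².

module Submission where

open import Defs
open import Data.Empty using (⊥; ⊥-elim)
open import Data.Fin using (Fin; toℕ; fromℕ<)
open import Data.Fin.Properties using (toℕ-injective; toℕ<n; toℕ-fromℕ<)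
import Data.Fin.Properties as Fin
open import Data.List using (List; []; _∷_; _++_; length; map; filter; deduplicate; allFin; cartesianProductWith)
open import Data.List.Membership.Propositional using (_∈_)
open import Data.List.Membership.Propositional.Properties
  using (∈-allFin; ∈-cartesianProductWith⁺; ∈-cartesianProductWith⁻; ∈-filter⁺; ∈-map⁺; ∈-deduplicate⁺; deduplicate-∈⇔)
open import Data.List.Membership.Propositional.Properties.WithK using (unique∧set⇒bag)
open import Data.List.Properties
  using ( filter-accept; filter-reject; filter-all; filter-none; filter-++; filter-≐; length-filter
        ; map-++; length-map; length-++; length-removeAt′; length-tabulate
        ; ++-identityʳ; ++-identityʳ-unique; ++-cancelˡ; ∷-injectiveˡ; ∷-injectiveʳ; ≡-dec)
open import Data.List.Relation.Binary.BagAndSetEquality using (∼bag⇒↭)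
open import Data.List.Relation.Binary.Permutation.Propositional.Properties using (↭-length)
open import Data.List.Relation.Unary.All as All using (All; []; _∷_)
open import Data.List.Relation.Unary.All.Properties
  using (all-filter; ¬Any⇒All¬)
  renaming (filter⁺ to All-filter⁺; map⁺ to All-map⁺; deduplicate⁺ to All-deduplicate⁺)
open import Data.List.Relation.Unary.AllPairs using (AllPairs; []; _∷_)
open import Data.List.Relation.Unary.Any as Any using (Any; here; there; _─_; any?)
open import Data.List.Relation.Unary.Any.Properties using () renaming (deduplicate⁺ to Any-deduplicate⁺)
open import Data.List.Relation.Unary.Linked as Linked using (Linked; []; _∷_; linked?)
import Data.List.Relation.Unary.Unique.DecSetoid.Properties as UniqueDecSetoid
open import Data.List.Relation.Unary.Unique.Propositional using (Unique)
open import Data.List.Relation.Unary.Unique.Propositional.Properties using (allFin⁺)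
open import Data.Nat using (ℕ; zero; suc; _+_; _*_; _∸_; _≤_; _<_; z≤n; s≤s)
import Data.Nat.Properties as ℕ
open import Data.Product using (_×_; _,_; ∃; ∃₂; Σ; proj₁; proj₂)
open import Data.Sum using (_⊎_; inj₁; inj₂; [_,_])
import Data.Sum as Sum
open import Function using (_∘_; _⇔_; mk⇔; Equivalence; Injective)
open import Level using (0ℓ)
open import Relation.Binary using (DecSetoid)
open import Relation.Binary.Construct.Closure.ReflexiveTransitive using (ε; _◅_; _◅◅_)
import Relation.Binary.Construct.Closure.ReflexiveTransitive as Star
open import Relation.Binary.Definitions using (DecidableEquality; tri<; tri≈; tri>)
open import Relation.Binary.PropositionalEquality
  using (_≡_; _≢_; refl; sym; trans; cong; cong₂; subst; subst₂; module ≡-Reasoning)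
open import Relation.Nullary using (¬_; Dec; yes; no; ¬?)
open import Relation.Nullary.Decidable using (map′; _⊎-dec_; _→-dec_)
open import Relation.Unary using (Pred; Decidable)

private variable
  n i k : ℕ

module _ {A : Set} where

  filter-comm : {P Q : Pred A 0ℓ} (P? : Decidable P) (Q? : Decidable Q) (xs : List A) →
                filter P? (filter Q? xs) ≡ filter Q? (filter P? xs)
  filter-comm P? Q? [] = refl
  filter-comm P? Q? (x ∷ xs) with P? x | Q? x
  ... | yes p | yes q rewrite filter-accept P? {x} {filter Q? xs} p | filter-accept Q? {x} {filter P? xs} q
    = cong (x ∷_) (filter-comm P? Q? xs)
  ... | yes _ | no ¬q = trans (filter-comm P? Q? xs) (sym (filter-reject Q? ¬q))
  ... | no ¬p | yes _ = trans (filter-reject P? ¬p) (filter-comm P? Q? xs)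
  ... | no  _ | no  _ = filter-comm P? Q? xs

  length-filter-filter : {P Q : Pred A 0ℓ} (P? : Decidable P) (Q? : Decidable Q) (xs : List A) →
                         length (filter P? (filter Q? xs)) ≤ length (filter P? xs)
  length-filter-filter P? Q? xs rewrite filter-comm P? Q? xs = length-filter Q? (filter P? xs)

module _ {A B : Set} (f : A → B) where

  map-filter : {P : Pred B 0ℓ} (P? : Decidable P) (xs : List A) →
               map f (filter (P? ∘ f) xs) ≡ filter P? (map f xs)
  map-filter P? [] = refl
  map-filter P? (x ∷ xs) with P? (f x)
  ... | yes _ = cong (f x ∷_) (map-filter P? xs)
  ... | no  _ = map-filter P? xs

  map-deduplicate : (_≟ᴬ_ : DecidableEquality A) (_≟ᴮ_ : DecidableEquality B) →
                    Injective _≡_ _≡_ f → (xs : List A) →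
                    map f (deduplicate _≟ᴬ_ xs) ≡ deduplicate _≟ᴮ_ (map f xs)
  map-deduplicate _≟ᴬ_ _≟ᴮ_ f-inj [] = refl
  map-deduplicate _≟ᴬ_ _≟ᴮ_ f-inj (x ∷ xs) = cong (f x ∷_) (begin
      map f (filter (¬? ∘ (x ≟ᴬ_)) (deduplicate _≟ᴬ_ xs))
        ≡⟨ cong (map f) (filter-≐ (¬? ∘ (x ≟ᴬ_)) (¬? ∘ (f x ≟ᴮ_) ∘ f)
                           ((λ x≢y fx≡fy → x≢y (f-inj fx≡fy)) , (λ fx≢fy x≡y → fx≢fy (cong f x≡y)))
                           (deduplicate _≟ᴬ_ xs)) ⟩
      map f (filter (¬? ∘ (f x ≟ᴮ_) ∘ f) (deduplicate _≟ᴬ_ xs))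
        ≡⟨ map-filter (¬? ∘ (f x ≟ᴮ_)) (deduplicate _≟ᴬ_ xs) ⟩
      filter (¬? ∘ (f x ≟ᴮ_)) (map f (deduplicate _≟ᴬ_ xs))
        ≡⟨ cong (filter (¬? ∘ (f x ≟ᴮ_))) (map-deduplicate _≟ᴬ_ _≟ᴮ_ f-inj xs) ⟩
      filter (¬? ∘ (f x ≟ᴮ_)) (deduplicate _≟ᴮ_ (map f xs)) ∎)
    where open ≡-Reasoning

module _ {A : Set} (_≟_ : DecidableEquality A) where

  filter-deduplicate : {P : Pred A 0ℓ} (P? : Decidable P) (xs : List A) →
                       filter P? (deduplicate _≟_ xs) ≡ deduplicate _≟_ (filter P? xs)
  filter-deduplicate P? [] = refl
  filter-deduplicate {P} P? (x ∷ xs) with P? x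
  ... | yes _ = cong (x ∷_) (trans (filter-comm P? x≢? (deduplicate _≟_ xs))
                                    (cong (filter x≢?) (filter-deduplicate P? xs)))
    where
    x≢? : Decidable (x ≢_)
    x≢? = ¬? ∘ (x ≟_)
  ... | no ¬Px = begin
      filter P? (filter x≢? (deduplicate _≟_ xs))  ≡⟨ filter-comm P? x≢? (deduplicate _≟_ xs) ⟩
      filter x≢? (filter P? (deduplicate _≟_ xs))  ≡⟨ cong (filter x≢?) (filter-deduplicate P? xs) ⟩
      filter x≢? (deduplicate _≟_ (filter P? xs))  ≡⟨ filter-all x≢? (All.map (λ Py x≡y → ¬Px (subst P (sym x≡y) Py))
                                                       (All-deduplicate⁺ _ (all-filter P? xs))) ⟩
      deduplicate _≟_ (filter P? xs)               ∎
    where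
    open ≡-Reasoning
    x≢? : Decidable (x ≢_)
    x≢? = ¬? ∘ (x ≟_)

  deduplicate-++-⊆ : {q r : List A} → Unique q → All (_∈ q) r → deduplicate _≟_ (q ++ r) ≡ q
  deduplicate-++-⊆ {[]}    {[]}    _          _  = refl
  deduplicate-++-⊆ {[]}    {_ ∷ _} _          (() ∷ _)
  deduplicate-++-⊆ {x ∷ q} {r}     (x∉q ∷ !q) r⊆ = cong (x ∷_) (begin
      filter x≢? (deduplicate _≟_ (q ++ r))   ≡⟨ filter-deduplicate x≢? (q ++ r) ⟩
      deduplicate _≟_ (filter x≢? (q ++ r))   ≡⟨ cong (deduplicate _≟_) (filter-++ x≢? q r) ⟩
      deduplicate _≟_ (filter x≢? q ++ filter x≢? r)
        ≡⟨ cong (λ q′ → deduplicate _≟_ (q′ ++ filter x≢? r)) (filter-all x≢? x∉q) ⟩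
      deduplicate _≟_ (q ++ filter x≢? r)     ≡⟨ deduplicate-++-⊆ !q r⊆q ⟩
      q                                        ∎)
    where
    open ≡-Reasoning
    x≢? : Decidable (x ≢_)
    x≢? = ¬? ∘ (x ≟_)
    inTail : ∀ {y} → x ≢ y → y ∈ x ∷ q → y ∈ q
    inTail x≢y (here y≡x) = ⊥-elim (x≢y (sym y≡x))
    inTail _   (there y∈q) = y∈q
    r⊆q : All (_∈ q) (filter x≢? r)
    r⊆q = All.zipWith (λ (x≢y , y∈) → inTail x≢y y∈) (all-filter x≢? r , All-filter⁺ x≢? r⊆)

  deduplicate-deduplicate-++ : (xs : List A) → deduplicate _≟_ (deduplicate _≟_ xs ++ xs) ≡ deduplicate _≟_ xs
  deduplicate-deduplicate-++ xs = deduplicate-++-⊆ (deduplicate-! xs) (All.tabulate (∈-deduplicate⁺ _≟_))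
    where open import Data.List.Relation.Unary.Unique.DecPropositional.Properties _≟_ using (deduplicate-!)

  deduplicate-++-injective : {xs ys : List A} →
                             deduplicate _≟_ xs ++ xs ≡ deduplicate _≟_ ys ++ ys → xs ≡ ys
  deduplicate-++-injective {xs} {ys} eq = ++-cancelˡ (deduplicate _≟_ xs) xs ys
    (trans eq (cong (_++ ys) (sym prefixes≡)))
    where
    prefixes≡ : deduplicate _≟_ xs ≡ deduplicate _≟_ ys
    prefixes≡ = trans (sym (deduplicate-deduplicate-++ xs))
                      (trans (cong (deduplicate _≟_) eq) (deduplicate-deduplicate-++ ys))

module _ {A : Set} {P : Pred A 0ℓ} (P? : Decidable P) where

  length-filter-split : (xs : List A) → length xs ≡ length (filter P? xs) + length (filter (¬? ∘ P?) xs)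
  length-filter-split [] = refl
  length-filter-split (x ∷ xs) with P? x
  ... | yes _ = cong suc (length-filter-split xs)
  ... | no  _ = trans (cong suc (length-filter-split xs)) (sym (ℕ.+-suc _ _))

count : ℕ → List ℕ → ℕ
count j = length ∘ filter (ℕ._≟ j)

count-hit : ∀ j l → count j (j ∷ l) ≡ suc (count j l)
count-hit j l = cong length (filter-accept (ℕ._≟ j) refl)

count-miss : ∀ {x j} l → x ≢ j → count j (x ∷ l) ≡ count j l
count-miss l x≢j = cong length (filter-reject (ℕ._≟ _) x≢j)

count-alternating : ∀ {u v} → u ≢ v → (l : List ℕ) → All (λ x → x ≡ u ⊎ x ≡ v) l → Linked _≢_ l →
                    count v l ≤ suc (count u l)
count-alternating u≢v [] _ _ = z≤n
count-alternating {u} {v} u≢v (x ∷ l) (inj₁ refl ∷ l∈) x∷l↯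
  rewrite count-hit u l | count-miss {u} l u≢v = ℕ.m≤n⇒m≤1+n (count-alternating u≢v l l∈ (Linked.tail x∷l↯))
count-alternating {u} {v} u≢v (x ∷ []) (inj₂ refl ∷ []) _
  rewrite count-hit v [] = s≤s z≤n
count-alternating u≢v (x ∷ y ∷ l) (inj₂ refl ∷ inj₂ refl ∷ _) (x≢y ∷ _) = ⊥-elim (x≢y refl)
count-alternating {u} {v} u≢v (x ∷ y ∷ l) (inj₂ refl ∷ inj₁ refl ∷ l∈) (_ ∷ y∷l↯)
  rewrite count-hit v (u ∷ l) | count-miss {u} l u≢v | count-miss {v} (u ∷ l) (u≢v ∘ sym) | count-hit u l
  = s≤s (count-alternating u≢v l l∈ (Linked.tail y∷l↯))

length-≤-counts : ∀ t {m} (l : List ℕ) → All (_< t) l → (∀ j → j < t → count j l ≤ m) → length l ≤ t * m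
length-≤-counts zero [] _ _ = z≤n
length-≤-counts zero (x ∷ l) (x<0 ∷ _) _ = ⊥-elim (ℕ.n≮0 x<0)
length-≤-counts (suc t) {m} l l<t counts≤ = begin
  length l                                    ≡⟨ length-filter-split (ℕ._≟ t) l ⟩
  count t l + length (filter ≢t? l)            ≤⟨ ℕ.+-mono-≤ (counts≤ t ℕ.≤-refl) (length-≤-counts t (filter ≢t? l) rest<t rest≤) ⟩
  m + t * m                                   ∎
  where
  open ℕ.≤-Reasoning
  ≢t? : Decidable (_≢ t)
  ≢t? = ¬? ∘ (ℕ._≟ t)
  rest<t : All (_< t) (filter ≢t? l)
  rest<t = All.zipWith (λ (x≢t , x<1+t) → ℕ.≤∧≢⇒< (ℕ.≤-pred x<1+t) x≢t) (all-filter ≢t? l , All-filter⁺ ≢t? l<t)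
  rest≤ : ∀ j → j < t → count j (filter ≢t? l) ≤ m
  rest≤ j j<t = ℕ.≤-trans (length-filter-filter (ℕ._≟ j) ≢t? l) (counts≤ j (ℕ.m≤n⇒m≤1+n j<t))

Linked-++⁻ʳ : {A : Set} {R : A → A → Set} (xs : List A) {ys : List A} → Linked R (xs ++ ys) → Linked R ys
Linked-++⁻ʳ []       xs++ys↯ = xs++ys↯
Linked-++⁻ʳ (x ∷ xs) xs++ys↯ = Linked-++⁻ʳ xs (Linked.tail xs++ys↯)

module _ {X Y : Set} (R : X → X → Set) (S : X → Y → Set)
         (S-injective : ∀ {a a′ b} → S a b → S a′ b → R a a′) where

  length-≤-injection : (as : List X) (bs : List Y) → AllPairs (λ a a′ → ¬ R a a′) as →
                       All (λ a → Any (S a) bs) as → length as ≤ length bs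
  length-≤-injection []       bs _          _            = z≤n
  length-≤-injection (a ∷ as) bs (a≁ ∷ as!) (a↦ ∷ as↦) =
    subst (suc (length as) ≤_) (sym (length-removeAt′ bs (Any.index a↦)))
      (s≤s (length-≤-injection as (bs ─ a↦) as! (All.zipWith (λ (a≁a′ , a′↦) → survives a↦ a′↦ a≁a′) (a≁ , as↦))))
    where
    survives : ∀ {a′} {bs} (a↦ : Any (S a) bs) → Any (S a′) bs → ¬ R a a′ → Any (S a′) (bs ─ a↦)
    survives (here  Sab) (here  Sa′b) a≁a′ = ⊥-elim (a≁a′ (S-injective Sab Sa′b))
    survives (here  _)   (there a′↦)  _    = a′↦
    survives (there _)   (here  Sa′b) _    = here Sa′b
    survives (there a↦)  (there a′↦)  a≁a′ = there (survives a↦ a′↦ a≁a′)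

-- Projections onto the edges of the path

OnEdge : ℕ → ℕ → Set
OnEdge i v = v ≡ i ⊎ v ≡ suc i

onEdge? : ∀ i → Decidable (OnEdge i)
onEdge? i v = (v ℕ.≟ i) ⊎-dec (v ℕ.≟ suc i)

proj-filter : ∀ i (w : Word n) → proj i w ≡ filter (onEdge? i) (map toℕ w)
proj-filter i [] = refl
proj-filter i (x ∷ w) with toℕ x ℕ.≟ i | toℕ x ℕ.≟ suc i
... | yes x≡i | _       = trans (cong (toℕ x ∷_) (proj-filter i w)) (sym (filter-accept (onEdge? i) (inj₁ x≡i)))
... | no _    | yes x≡i′ = trans (cong (toℕ x ∷_) (proj-filter i w)) (sym (filter-accept (onEdge? i) (inj₂ x≡i′)))
... | no x≢i  | no x≢i′  = trans (proj-filter i w) (sym (filter-reject (onEdge? i) [ x≢i , x≢i′ ]))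

proj-++ : ∀ i (u v : Word n) → proj i (u ++ v) ≡ proj i u ++ proj i v
proj-++ i u v rewrite proj-filter i (u ++ v) | proj-filter i u | proj-filter i v | map-++ toℕ u v =
  filter-++ (onEdge? i) (map toℕ u) (map toℕ v)

proj-∷-on : ∀ {x : Fin n} w → OnEdge i (toℕ x) → proj i (x ∷ w) ≡ toℕ x ∷ proj i w
proj-∷-on {i = i} {x} w x∈i rewrite proj-filter i (x ∷ w) | proj-filter i w = filter-accept (onEdge? i) x∈i

proj-∷-off : ∀ {x : Fin n} w → ¬ OnEdge i (toℕ x) → proj i (x ∷ w) ≡ proj i w
proj-∷-off {i = i} {x} w x∉i rewrite proj-filter i (x ∷ w) | proj-filter i w = filter-reject (onEdge? i) x∉i

proj-onEdge : ∀ i (w : Word n) → All (OnEdge i) (proj i w)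
proj-onEdge i w = subst (All (OnEdge i)) (sym (proj-filter i w)) (all-filter (onEdge? i) (map toℕ w))

∈-proj : ∀ {x : Fin n} {w} → x ∈ w → OnEdge i (toℕ x) → toℕ x ∈ proj i w
∈-proj {i = i} {w = w} x∈w x∈i = subst (_ ∈_) (sym (proj-filter i w)) (∈-filter⁺ (onEdge? i) (∈-map⁺ toℕ x∈w) x∈i)

proj-< : ∀ i (w : Word n) → All (_< n) (proj i w)
proj-< i w = subst (All (_< _)) (sym (proj-filter i w))
  (All-filter⁺ (onEdge? i) {xs = map toℕ w} (All-map⁺ (All.tabulate (λ {x} _ → toℕ<n x))))

onEdge⇒≥ : ∀ {v} → OnEdge i v → i ≤ v
onEdge⇒≥ (inj₁ refl) = ℕ.≤-refl
onEdge⇒≥ (inj₂ refl) = ℕ.n≤1+n _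

onEdge-close : ∀ {a b} → OnEdge i a → OnEdge i b → b ≤ suc a
onEdge-close (inj₁ refl) (inj₁ refl) = ℕ.n≤1+n _
onEdge-close (inj₁ refl) (inj₂ refl) = ℕ.≤-refl
onEdge-close (inj₂ refl) (inj₁ refl) = ℕ.≤-trans (ℕ.n≤1+n _) (ℕ.n≤1+n _)
onEdge-close (inj₂ refl) (inj₂ refl) = ℕ.n≤1+n _

far⇒no-common-edge : {a b : Fin n} → Far a b → OnEdge i (toℕ a) → OnEdge i (toℕ b) → ⊥
far⇒no-common-edge (inj₁ 2+a≤b) a∈i b∈i = ℕ.<-irrefl refl (ℕ.≤-trans 2+a≤b (onEdge-close a∈i b∈i))
far⇒no-common-edge (inj₂ 2+b≤a) a∈i b∈i = ℕ.<-irrefl refl (ℕ.≤-trans 2+b≤a (onEdge-close b∈i a∈i))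

no-common-edge⇒far : {a b : Fin n} → toℕ a ≢ toℕ b → (∀ i → OnEdge i (toℕ a) → OnEdge i (toℕ b) → ⊥) → Far a b
no-common-edge⇒far {a = a} {b} a≢b disjoint with ℕ.<-cmp (toℕ a) (toℕ b)
... | tri< a<b _ _ = inj₁ (ℕ.≤∧≢⇒< a<b (λ 1+a≡b → disjoint (toℕ a) (inj₁ refl) (inj₂ (sym 1+a≡b))))
... | tri≈ _ a≡b _ = ⊥-elim (a≢b a≡b)
... | tri> _ _ b<a = inj₂ (ℕ.≤∧≢⇒< b<a (λ 1+b≡a → disjoint (toℕ b) (inj₂ (sym 1+b≡a)) (inj₁ refl)))

swap-sym : {u v : Word n} → Swap u v → Swap v u
swap-sym (swap xs ys a b (inj₁ a≪b)) = swap xs ys b a (inj₂ a≪b)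
swap-sym (swap xs ys a b (inj₂ b≪a)) = swap xs ys b a (inj₁ b≪a)

∼-sym : {u v : Word n} → u ∼ v → v ∼ u
∼-sym = Star.reverse swap-sym

∼-cons : (x : Fin n) {u v : Word n} → u ∼ v → (x ∷ u) ∼ (x ∷ v)
∼-cons x = Star.gmap (x ∷_) swap-cons
  where
  swap-cons : {u v : Word _} → Swap u v → Swap (x ∷ u) (x ∷ v)
  swap-cons (swap xs ys a b far) = swap (x ∷ xs) ys a b far

proj-swap : {a b : Fin n} (ys : Word n) → Far a b → proj i (a ∷ b ∷ ys) ≡ proj i (b ∷ a ∷ ys)
proj-swap {i = i} {a = a} {b} ys far with onEdge? i (toℕ a) | onEdge? i (toℕ b)
... | yes a∈ | yes b∈ = ⊥-elim (far⇒no-common-edge far a∈ b∈)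
... | yes a∈ | no b∉ = trans (proj-∷-on (b ∷ ys) a∈) (trans (cong (toℕ a ∷_) (proj-∷-off ys b∉))
                        (sym (trans (proj-∷-off (a ∷ ys) b∉) (proj-∷-on ys a∈))))
... | no a∉ | yes b∈ = trans (proj-∷-off (b ∷ ys) a∉) (trans (proj-∷-on ys b∈)
                        (sym (trans (proj-∷-on (a ∷ ys) b∈) (cong (toℕ b ∷_) (proj-∷-off ys a∉)))))
... | no a∉ | no b∉  = trans (proj-∷-off (b ∷ ys) a∉) (trans (proj-∷-off ys b∉)
                        (sym (trans (proj-∷-off (a ∷ ys) b∉) (proj-∷-off ys a∉))))

∼⇒proj≡ : {u v : Word n} → u ∼ v → ∀ i → proj i u ≡ proj i v
∼⇒proj≡ ε i = refl
∼⇒proj≡ (swap xs ys a b far ◅ v∼w) i = trans (trans (proj-++ i xs (a ∷ b ∷ ys))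
  (trans (cong (proj i xs ++_) (proj-swap ys far)) (sym (proj-++ i xs (b ∷ a ∷ ys))))) (∼⇒proj≡ v∼w i)

Minimal : Fin n → Word n → Set
Minimal x v = ∀ i → OnEdge i (toℕ x) → ∃ λ s → proj i v ≡ toℕ x ∷ s

pull-minimal : (x : Fin n) (v : Word n) → Minimal x v → ∃ λ v′ → v ∼ (x ∷ v′)
pull-minimal x [] min with min (toℕ x) (inj₁ refl)
... | _ , ()
pull-minimal x (b ∷ v) min with b Fin.≟ x
... | yes refl = v , ε
... | no b≢x = b ∷ v′ , (∼-cons b v∼xv′ ◅◅ (swap [] v′ b x b≪≫x ◅ ε))
  where
  no-common-edge : ∀ i → OnEdge i (toℕ b) → OnEdge i (toℕ x) → ⊥
  no-common-edge i b∈ x∈ =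
    b≢x (toℕ-injective (∷-injectiveˡ (trans (sym (proj-∷-on v b∈)) (proj₂ (min i x∈)))))
  b≪≫x : Far b x
  b≪≫x = no-common-edge⇒far (λ b≡x → b≢x (toℕ-injective b≡x)) no-common-edge
  min′ : Minimal x v
  min′ i x∈ = proj₁ (min i x∈) , trans (sym (proj-∷-off v (λ b∈ → no-common-edge i b∈ x∈))) (proj₂ (min i x∈))
  v′ : Word _
  v′ = proj₁ (pull-minimal x v min′)
  v∼xv′ : v ∼ (x ∷ v′)
  v∼xv′ = proj₂ (pull-minimal x v min′)

-- c is an initial segment of the heap b
_⊑_ : Word n → Word n → Set
c ⊑ b = ∀ i → ∃ λ s → proj i b ≡ proj i c ++ s

proj-∷-cancel : (x : Fin n) (u u′ : Word n) {s : List ℕ} →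
                proj i (x ∷ u) ≡ proj i (x ∷ u′) ++ s → proj i u ≡ proj i u′ ++ s
proj-∷-cancel {i = i} x u u′ {s} eq with onEdge? i (toℕ x)
... | yes x∈ = ∷-injectiveʳ (trans (sym (proj-∷-on u x∈)) (trans eq (cong (_++ s) (proj-∷-on u′ x∈))))
... | no x∉  = trans (sym (proj-∷-off u x∉)) (trans eq (cong (_++ s) (proj-∷-off u′ x∉)))

pull-prefix : (c b : Word n) → c ⊑ b → ∃ λ a → b ∼ (c ++ a)
pull-prefix [] b _ = b , ε
pull-prefix (x ∷ c) b x∷c⊑b = a , (b∼xb′ ◅◅ ∼-cons x b′∼ca)
  where
  minimal : Minimal x b
  minimal i x∈ = proj i c ++ proj₁ (x∷c⊑b i) , trans (proj₂ (x∷c⊑b i)) (cong (_++ _) (proj-∷-on c x∈))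
  b′ : Word _
  b′ = proj₁ (pull-minimal x b minimal)
  b∼xb′ : b ∼ (x ∷ b′)
  b∼xb′ = proj₂ (pull-minimal x b minimal)
  c⊑b′ : c ⊑ b′
  c⊑b′ i = proj₁ (x∷c⊑b i) , proj-∷-cancel x b′ c (trans (sym (∼⇒proj≡ b∼xb′ i)) (proj₂ (x∷c⊑b i)))
  a : Word _
  a = proj₁ (pull-prefix c b′ c⊑b′)
  b′∼ca : b′ ∼ (c ++ a)
  b′∼ca = proj₂ (pull-prefix c b′ c⊑b′)

proj-[]⇒[] : (a : Word n) → (∀ i → proj i a ≡ []) → a ≡ []
proj-[]⇒[] []      _        = refl
proj-[]⇒[] (y ∷ a) proj≡[] with () ← trans (sym (proj-∷-on {x = y} a (inj₁ refl))) (proj≡[] (toℕ y))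

proj≡⇒∼ : {w v : Word n} → (∀ i → proj i w ≡ proj i v) → w ∼ v
proj≡⇒∼ {w = w} {v} proj≡ = ∼-sym (subst (v ∼_) (trans (cong (w ++_) a≡[]) (++-identityʳ w)) v∼wa)
  where
  w⊑v : w ⊑ v
  w⊑v i = [] , trans (sym (proj≡ i)) (sym (++-identityʳ (proj i w)))
  a : Word _
  a = proj₁ (pull-prefix w v w⊑v)
  v∼wa : v ∼ (w ++ a)
  v∼wa = proj₂ (pull-prefix w v w⊑v)
  a≡[] : a ≡ []
  a≡[] = proj-[]⇒[] a λ i → ++-identityʳ-unique (proj i w)
    (trans (proj≡ i) (trans (∼⇒proj≡ v∼wa i) (proj-++ i w a)))

∼-length : {u v : Word n} → u ∼ v → length u ≡ length v
∼-length ε = refl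
∼-length (swap xs _ _ _ _ ◅ v∼w) = trans (trans (length-++ xs) (sym (length-++ xs))) (∼-length v∼w)

∼-++ʳ : {c c′ : Word n} (a : Word n) → c ∼ c′ → (c ++ a) ∼ (c′ ++ a)
∼-++ʳ {c = c} {c′} a c∼c′ = proj≡⇒∼ λ i →
  trans (proj-++ i c a) (trans (cong (_++ proj i a) (∼⇒proj≡ c∼c′ i)) (sym (proj-++ i c′ a)))

alternating-resp-∼ : {w v : Word n} → w ∼ v → Alternating w → Alternating v
alternating-resp-∼ w∼v alt i 1+i<n = subst (Linked _≢_) (∼⇒proj≡ w∼v i) (alt i 1+i<n)

alternating-++⁻ʳ : (c : Word n) {a : Word n} → Alternating (c ++ a) → Alternating a
alternating-++⁻ʳ c {a} alt i 1+i<n = Linked-++⁻ʳ (proj i c) (subst (Linked _≢_) (proj-++ i c a) (alt i 1+i<n))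

-- Enumerating the alternating heaps of a given size

proj-beyond : (w : Word n) → n ≤ i → proj i w ≡ []
proj-beyond []      _   = refl
proj-beyond (x ∷ w) n≤i = trans (proj-∷-off w x∉i) (proj-beyond w n≤i)
  where
  x∉i : ¬ OnEdge _ (toℕ x)
  x∉i x∈i = ℕ.<⇒≱ (ℕ.<-≤-trans (toℕ<n x) n≤i) (onEdge⇒≥ x∈i)

all-indices? : {P : ℕ → Set} → (∀ i → Dec (P i)) → (∀ i → n ≤ i → P i) → Dec (∀ i → P i)
all-indices? {n = n} {P} P? beyond = map′ extend (λ ∀P j → ∀P (toℕ j)) (Fin.all? (λ (j : Fin n) → P? (toℕ j)))
  where
  extend : (∀ (j : Fin n) → P (toℕ j)) → ∀ i → P i
  extend below i with i ℕ.<? n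
  ... | yes i<n = subst P (toℕ-fromℕ< i<n) (below (fromℕ< i<n))
  ... | no  i≮n = beyond i (ℕ.≮⇒≥ i≮n)

_∼?_ : (w v : Word n) → Dec (w ∼ v)
w ∼? v = map′ proj≡⇒∼ ∼⇒proj≡
  (all-indices? (λ i → ≡-dec ℕ._≟_ (proj i w) (proj i v))
                (λ i n≤i → trans (proj-beyond w n≤i) (sym (proj-beyond v n≤i))))

alternating? : (w : Word n) → Dec (Alternating w)
alternating? {n} w = all-indices? (λ i → suc i ℕ.<? n →-dec linked? (λ x y → ¬? (x ℕ.≟ y)) (proj i w))
  (λ i n≤i 1+i<n → ⊥-elim (ℕ.<⇒≱ (ℕ.<-trans (ℕ.n<1+n i) 1+i<n) n≤i))

∼-decSetoid : ℕ → DecSetoid 0ℓ 0ℓ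
∼-decSetoid n = record
  { Carrier = Word n
  ; _≈_ = _∼_
  ; isDecEquivalence = record
    { isEquivalence = record { refl = ε ; sym = ∼-sym ; trans = _◅◅_ }
    ; _≟_ = _∼?_
    }
  }

words : (n k : ℕ) → List (Word n)
words n zero    = [] ∷ []
words n (suc k) = cartesianProductWith _∷_ (allFin n) (words n k)

∈-words : (w : Word n) → w ∈ words n (length w)
∈-words []      = here refl
∈-words (x ∷ w) = ∈-cartesianProductWith⁺ _∷_ (∈-allFin x) (∈-words w)

words-length : ∀ k {w : Word n} → w ∈ words n k → length w ≡ k
words-length zero    (here refl) = refl
words-length (suc k) w∈ with ∈-cartesianProductWith⁻ _∷_ (allFin _) (words _ k) w∈
... | _ , _ , _ , w′∈ , refl = cong suc (words-length k w′∈)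

heaps : (n k : ℕ) → List (Word n)
heaps n k = deduplicate _∼?_ (filter alternating? (words n k))

heaps-isHeapEnum : ∀ n k → IsHeapEnum n k (heaps n k)
heaps-isHeapEnum n k =
  All-deduplicate⁺ _∼?_ (All.zipWith (λ (alt , len) → len , alt)
    (all-filter alternating? (words n k) , All-filter⁺ alternating? (All.tabulate (words-length k)))) ,
  UniqueDecSetoid.deduplicate-! (∼-decSetoid n) (filter alternating? (words n k)) ,
  λ w len alt → Any-deduplicate⁺ _∼?_ (λ y∼x w∼y → w∼y ◅◅ ∼-sym y∼x)
    (Any.map (λ { refl → ε }) (∈-filter⁺ alternating? (subst (λ k → w ∈ words n k) len (∈-words w)) alt))

-- Long alternating heaps use every letter

FullSupport : Word n → Set
FullSupport {n} w = (x : Fin n) → x ∈ w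

occurrences : ℕ → Word n → ℕ
occurrences j w = count j (map toℕ w)

count-proj : ∀ {j} (w : Word n) → OnEdge i j → count j (proj i w) ≡ occurrences j w
count-proj {i = i} {j} w j∈i = begin
  length (filter (ℕ._≟ j) (proj i w))                         ≡⟨ cong (length ∘ filter (ℕ._≟ j)) (proj-filter i w) ⟩
  length (filter (ℕ._≟ j) (filter (onEdge? i) (map toℕ w)))   ≡⟨ cong length (filter-comm (ℕ._≟ j) (onEdge? i) (map toℕ w)) ⟩
  length (filter (onEdge? i) (filter (ℕ._≟ j) (map toℕ w)))   ≡⟨ cong length (filter-all (onEdge? i)
                                                                    (All.map (λ { refl → j∈i }) (all-filter (ℕ._≟ j) (map toℕ w)))) ⟩
  length (filter (ℕ._≟ j) (map toℕ w))                        ∎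
  where
  open ≡-Reasoning

module _ {w : Word n} (alt : Alternating w) where

  occurrences-neighbours : ∀ i → suc i < n →
                           occurrences (suc i) w ≤ suc (occurrences i w) × occurrences i w ≤ suc (occurrences (suc i) w)
  occurrences-neighbours i 1+i<n =
    subst₂ (λ c c′ → c′ ≤ suc c) (count-proj w (inj₁ refl)) (count-proj w (inj₂ refl))
      (count-alternating i≢1+i (proj i w) (proj-onEdge i w) (alt i 1+i<n)) ,
    subst₂ (λ c c′ → c′ ≤ suc c) (count-proj w (inj₂ refl)) (count-proj w (inj₁ refl))
      (count-alternating (i≢1+i ∘ sym) (proj i w) (All.map Sum.swap (proj-onEdge i w)) (alt i 1+i<n))
    where
    i≢1+i : i ≢ suc i
    i≢1+i = ℕ.<⇒≢ (ℕ.n<1+n i)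

  occurrences-drift : ∀ i d → i + d < n →
                      occurrences (i + d) w ≤ d + occurrences i w × occurrences i w ≤ d + occurrences (i + d) w
  occurrences-drift i zero    _ rewrite ℕ.+-identityʳ i = ℕ.≤-refl , ℕ.≤-refl
  occurrences-drift i (suc d) 1+i+d<n rewrite ℕ.+-suc i d =
    ℕ.≤-trans up′ (s≤s up) ,
    ℕ.≤-trans down (ℕ.≤-trans (ℕ.+-monoʳ-≤ d down′) (ℕ.≤-reflexive (ℕ.+-suc d _)))
    where
    up : occurrences (i + d) w ≤ d + occurrences i w
    up = proj₁ (occurrences-drift i d (ℕ.<-trans (ℕ.n<1+n _) 1+i+d<n))
    down : occurrences i w ≤ d + occurrences (i + d) w
    down = proj₂ (occurrences-drift i d (ℕ.<-trans (ℕ.n<1+n _) 1+i+d<n))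
    up′ : occurrences (suc (i + d)) w ≤ suc (occurrences (i + d) w)
    up′ = proj₁ (occurrences-neighbours (i + d) 1+i+d<n)
    down′ : occurrences (i + d) w ≤ suc (occurrences (suc (i + d)) w)
    down′ = proj₂ (occurrences-neighbours (i + d) 1+i+d<n)

  -- Counts grow by at most one per step away from the missing letter a.
  absent⇒occurrences≤ : ∀ a → a < n → occurrences a w ≡ 0 → ∀ j → j < n → occurrences j w ≤ n
  absent⇒occurrences≤ a a<n a-absent j j<n with ℕ.≤-total a j
  ... | inj₁ a≤j = begin
    occurrences j w              ≡⟨ cong (λ k → occurrences k w) (sym (ℕ.m+[n∸m]≡n a≤j)) ⟩
    occurrences (a + (j ∸ a)) w  ≤⟨ proj₁ (occurrences-drift a (j ∸ a) (subst (_< n) (sym (ℕ.m+[n∸m]≡n a≤j)) j<n)) ⟩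
    (j ∸ a) + occurrences a w    ≡⟨ cong ((j ∸ a) +_) a-absent ⟩
    (j ∸ a) + 0                  ≡⟨ ℕ.+-identityʳ _ ⟩
    j ∸ a                        ≤⟨ ℕ.m∸n≤m j a ⟩
    j                            ≤⟨ ℕ.<⇒≤ j<n ⟩
    n                            ∎
    where open ℕ.≤-Reasoning
  ... | inj₂ j≤a = begin
    occurrences j w                        ≤⟨ proj₂ (occurrences-drift j (a ∸ j) (subst (_< n) (sym (ℕ.m+[n∸m]≡n j≤a)) a<n)) ⟩
    (a ∸ j) + occurrences (j + (a ∸ j)) w  ≡⟨ cong (λ k → (a ∸ j) + occurrences k w) (ℕ.m+[n∸m]≡n j≤a) ⟩
    (a ∸ j) + occurrences a w              ≡⟨ cong ((a ∸ j) +_) a-absent ⟩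
    (a ∸ j) + 0                            ≡⟨ ℕ.+-identityʳ _ ⟩
    a ∸ j                                  ≤⟨ ℕ.m∸n≤m a j ⟩
    a                                      ≤⟨ ℕ.<⇒≤ a<n ⟩
    n                                      ∎
    where open ℕ.≤-Reasoning

  long⇒fullSupport : n * n < length w → FullSupport w
  long⇒fullSupport long x with any? (x Fin.≟_) w
  ... | yes x∈w = x∈w
  ... | no  x∉w = ⊥-elim (ℕ.<⇒≱ long (begin
    length w            ≡⟨ sym (length-map toℕ w) ⟩
    length (map toℕ w)  ≤⟨ length-≤-counts n (map toℕ w) (All-map⁺ (All.tabulate (λ {y} _ → toℕ<n y)))
                             (absent⇒occurrences≤ (toℕ x) (toℕ<n x) x-absent) ⟩
    n * n               ∎))
    where
    open ℕ.≤-Reasoning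
    x-absent : occurrences (toℕ x) w ≡ 0
    x-absent = cong length (filter-none (ℕ._≟ toℕ x) (All-map⁺
      (All.map (λ x≢y y≡x → x≢y (sym (toℕ-injective y≡x))) (¬Any⇒All¬ w x∉w))))

Ends : ℕ → ℕ → ℕ → Set
Ends i x y = (x ≡ i × y ≡ suc i) ⊎ (x ≡ suc i × y ≡ i)

ends-distinct : ∀ {x y} → Ends i x y → x ≢ y
ends-distinct (inj₁ (refl , refl)) = ℕ.<⇒≢ (ℕ.n<1+n _)
ends-distinct (inj₂ (refl , refl)) = ℕ.<⇒≢ (ℕ.n<1+n _) ∘ sym

ends-cover : ∀ {x y v} → Ends i x y → OnEdge i v → v ≡ x ⊎ v ≡ y
ends-cover (inj₁ (refl , refl)) v∈i = v∈i
ends-cover (inj₂ (refl , refl)) v∈i = Sum.swap v∈i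

distinct⇒ends : ∀ {x y} → OnEdge i x → OnEdge i y → x ≢ y → Ends i x y
distinct⇒ends (inj₁ refl) (inj₁ refl) x≢y = ⊥-elim (x≢y refl)
distinct⇒ends (inj₁ refl) (inj₂ refl) _   = inj₁ (refl , refl)
distinct⇒ends (inj₂ refl) (inj₁ refl) _   = inj₂ (refl , refl)
distinct⇒ends (inj₂ refl) (inj₂ refl) x≢y = ⊥-elim (x≢y refl)

ends-determined : ∀ {x y x′ y′} → Ends i x y → Ends i x′ y′ → y ≢ x′ → x ≡ x′ × y ≡ y′
ends-determined (inj₁ (refl , refl)) (inj₁ (refl , refl)) _   = refl , refl
ends-determined (inj₁ (refl , refl)) (inj₂ (refl , refl)) y≢x′ = ⊥-elim (y≢x′ refl)
ends-determined (inj₂ (refl , refl)) (inj₁ (refl , refl)) y≢x′ = ⊥-elim (y≢x′ refl)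
ends-determined (inj₂ (refl , refl)) (inj₂ (refl , refl)) _   = refl , refl

-- The shape of proj i of an alternating word using every letter: the first occurrences q of the
-- letters on edge i, then repetitions r of them.
data Opening (n i : ℕ) : List ℕ → List ℕ → Set where
  inner  : ∀ {x y r} → suc i < n → Ends i x y → All (λ v → v ≡ x ⊎ v ≡ y) r → Linked _≢_ (x ∷ y ∷ r) →
           Opening n i (x ∷ y ∷ []) r
  last   : ∀ {r} → suc i ≡ n → All (_≡ i) r → Opening n i (i ∷ []) r
  beyond : n ≤ i → Opening n i [] []

opening-deduplicate : ∀ {q r} → Opening n i q r → deduplicate ℕ._≟_ (q ++ r) ≡ q
opening-deduplicate (inner _ ends r∈ _) = deduplicate-++-⊆ ℕ._≟_ ((ends-distinct ends ∷ []) ∷ [] ∷ [])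
  (All.map (λ { (inj₁ refl) → here refl ; (inj₂ refl) → there (here refl) }) r∈)
opening-deduplicate (last _ r∈) = deduplicate-++-⊆ ℕ._≟_ ([] ∷ []) (All.map here r∈)
opening-deduplicate (beyond _) = refl

opening-repeats : ∀ {q q′ r′} → Opening n i q (q′ ++ r′) → Opening n i q′ r′ → q′ ≡ q
opening-repeats (inner _ ends _ (_ ∷ y≢x′ ∷ _)) (inner _ ends′ _ _) with ends-determined ends ends′ y≢x′
... | refl , refl = refl
opening-repeats (last _ _)  (last _ _)   = refl
opening-repeats (beyond _)  (beyond _)   = refl
opening-repeats (inner 1+i<n _ _ _) (last 1+i≡n _) = ⊥-elim (ℕ.<-irrefl 1+i≡n 1+i<n)
opening-repeats (last 1+i≡n _) (inner 1+i<n _ _ _) = ⊥-elim (ℕ.<-irrefl 1+i≡n 1+i<n)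
opening-repeats (inner 1+i<n _ _ _) (beyond n≤i) = ⊥-elim (ℕ.<⇒≱ (ℕ.<-trans (ℕ.n<1+n _) 1+i<n) n≤i)
opening-repeats (last 1+i≡n _) (beyond n≤i) = ⊥-elim (ℕ.<⇒≱ (ℕ.<-≤-trans (ℕ.n<1+n _) (ℕ.≤-reflexive 1+i≡n)) n≤i)

opening-doubled : ∀ {q r} → suc i < n → Opening n i q r → Linked _≢_ (q ++ r) → Linked _≢_ (q ++ q ++ r)
opening-doubled _ (inner _ ends _ _) x∷y∷r↯ = ends-distinct ends ∷ (ends-distinct ends ∘ sym) ∷ x∷y∷r↯
opening-doubled 1+i<n (last 1+i≡n _) _ = ⊥-elim (ℕ.<-irrefl 1+i≡n 1+i<n)
opening-doubled 1+i<n (beyond n≤i) _ = ⊥-elim (ℕ.<⇒≱ (ℕ.<-trans (ℕ.n<1+n _) 1+i<n) n≤i)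

onEdge-last : ∀ {v} → suc i ≡ n → OnEdge i v → v < n → v ≡ i
onEdge-last _     (inj₁ v≡i) _   = v≡i
onEdge-last 1+i≡n (inj₂ refl) v<n = ⊥-elim (ℕ.<-irrefl 1+i≡n v<n)

opening : (l : List ℕ) → All (OnEdge i) l → All (_< n) l → (suc i < n → Linked _≢_ l) →
          (i < n → i ∈ l) → (suc i < n → suc i ∈ l) → ∃₂ λ q r → l ≡ q ++ r × Opening n i q r
opening {i} {n} l l∈i l<n alt i∈ 1+i∈ with ℕ.<-cmp (suc i) n
opening []          _ _ _ _ 1+i∈ | tri< 1+i<n _ _ with () ← 1+i∈ 1+i<n
opening (x ∷ [])    _ _ _ i∈ 1+i∈ | tri< 1+i<n _ _
  with here refl ← i∈ (ℕ.<-trans (ℕ.n<1+n _) 1+i<n) | here 1+i≡i ← 1+i∈ 1+i<n = ⊥-elim (ℕ.<⇒≢ (ℕ.n<1+n _) (sym 1+i≡i))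
opening (x ∷ y ∷ r) (x∈i ∷ y∈i ∷ r∈i) _ alt _ _ | tri< 1+i<n _ _ =
  x ∷ y ∷ [] , r , refl , inner 1+i<n ends (All.map (ends-cover ends) r∈i) (alt 1+i<n)
  where ends = distinct⇒ends x∈i y∈i (Linked.head (alt 1+i<n))
opening []          _ _ _ i∈ _ | tri≈ _ 1+i≡n _ with () ← i∈ (ℕ.<-≤-trans (ℕ.n<1+n _) (ℕ.≤-reflexive 1+i≡n))
opening (x ∷ r) (x∈i ∷ r∈i) (x<n ∷ r<n) _ _ _ | tri≈ _ 1+i≡n _ with refl ← onEdge-last 1+i≡n x∈i x<n =
  _ ∷ [] , r , refl , last 1+i≡n (All.zipWith (λ (v∈i , v<n) → onEdge-last 1+i≡n v∈i v<n) (r∈i , r<n))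
opening []          _ _ _ _ _ | tri> _ _ n<1+i = [] , [] , refl , beyond (ℕ.≤-pred n<1+i)
opening (x ∷ _)     (x∈i ∷ _) (x<n ∷ _) _ _ _ | tri> _ _ n<1+i =
  ⊥-elim (ℕ.<⇒≱ (ℕ.<-≤-trans x<n (ℕ.≤-pred n<1+i)) (onEdge⇒≥ x∈i))

module _ {w : Word n} (alt : Alternating w) (full : FullSupport w) where

  proj-opening : ∀ i → ∃₂ λ q r → proj i w ≡ q ++ r × Opening n i q r
  proj-opening i = opening (proj i w) (proj-onEdge i w) (proj-< i w) (alt i)
    (λ i<n → letter∈ i<n (inj₁ refl)) (λ 1+i<n → letter∈ 1+i<n (inj₂ refl))
    where
    letter∈ : ∀ {j} → j < n → OnEdge i j → j ∈ proj i w
    letter∈ j<n j∈i = subst (_∈ proj i w) (toℕ-fromℕ< j<n)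
      (∈-proj (full (fromℕ< j<n)) (subst (OnEdge i) (sym (toℕ-fromℕ< j<n)) j∈i))

-- Prepending the first occurrences

firsts : Word n → Word n
firsts = deduplicate Fin._≟_

prependFirsts : Word n → Word n
prependFirsts w = firsts w ++ w

proj-firsts : ∀ i (w : Word n) → proj i (firsts w) ≡ deduplicate ℕ._≟_ (proj i w)
proj-firsts i w = begin
  proj i (firsts w)                                           ≡⟨ proj-filter i (firsts w) ⟩
  filter (onEdge? i) (map toℕ (firsts w))                     ≡⟨ cong (filter (onEdge? i)) (map-deduplicate toℕ Fin._≟_ ℕ._≟_ toℕ-injective w) ⟩
  filter (onEdge? i) (deduplicate ℕ._≟_ (map toℕ w))          ≡⟨ filter-deduplicate ℕ._≟_ (onEdge? i) (map toℕ w) ⟩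
  deduplicate ℕ._≟_ (filter (onEdge? i) (map toℕ w))          ≡⟨ cong (deduplicate ℕ._≟_) (sym (proj-filter i w)) ⟩
  deduplicate ℕ._≟_ (proj i w)                                ∎
  where open ≡-Reasoning

proj-prependFirsts : ∀ i (w : Word n) → proj i (prependFirsts w) ≡ deduplicate ℕ._≟_ (proj i w) ++ proj i w
proj-prependFirsts i w = trans (proj-++ i (firsts w) w) (cong (_++ proj i w) (proj-firsts i w))

prependFirsts-resp-∼ : {w v : Word n} → w ∼ v → prependFirsts w ∼ prependFirsts v
prependFirsts-resp-∼ {w = w} {v} w∼v = proj≡⇒∼ λ i → begin
  proj i (prependFirsts w)                         ≡⟨ proj-prependFirsts i w ⟩
  deduplicate ℕ._≟_ (proj i w) ++ proj i w         ≡⟨ cong (λ l → deduplicate ℕ._≟_ l ++ l) (∼⇒proj≡ w∼v i) ⟩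
  deduplicate ℕ._≟_ (proj i v) ++ proj i v         ≡⟨ proj-prependFirsts i v ⟨
  proj i (prependFirsts v)                         ∎
  where open ≡-Reasoning

prependFirsts-reflects-∼ : {w v : Word n} → prependFirsts w ∼ prependFirsts v → w ∼ v
prependFirsts-reflects-∼ {w = w} {v} pw∼pv = proj≡⇒∼ λ i → deduplicate-++-injective ℕ._≟_
  (trans (sym (proj-prependFirsts i w)) (trans (∼⇒proj≡ pw∼pv i) (proj-prependFirsts i v)))

length-firsts : {w : Word n} → FullSupport w → length (firsts w) ≡ n
length-firsts {n} {w} full = begin
  length (firsts w) ≡⟨ ↭-length (∼bag⇒↭ (unique∧set⇒bag (deduplicate-! w) (allFin⁺ n) same-letters)) ⟩
  length (allFin n) ≡⟨ length-tabulate (λ x → x) ⟩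
  n                 ∎
  where
  open ≡-Reasoning
  open import Data.List.Relation.Unary.Unique.DecPropositional.Properties Fin._≟_ using (deduplicate-!)
  same-letters : ∀ {x} → (x ∈ firsts w) ⇔ (x ∈ allFin n)
  same-letters {x} = mk⇔ (λ _ → ∈-allFin x) (λ _ → Equivalence.to (deduplicate-∈⇔ Fin._≟_) (full x))

proj-firsts-opening : (w : Word n) {q r : List ℕ} → proj i w ≡ q ++ r → Opening n i q r → proj i (firsts w) ≡ q
proj-firsts-opening {i = i} w w≡qr o = trans (proj-firsts i w) (trans (cong (deduplicate ℕ._≟_) w≡qr) (opening-deduplicate o))

module _ {w : Word n} (alt : Alternating w) (full : FullSupport w) where

  prependFirsts-alternating : Alternating (prependFirsts w)
  prependFirsts-alternating i 1+i<n with proj-opening alt full i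
  ... | q , r , w≡qr , o = subst (Linked _≢_) (sym proj≡qqr)
          (opening-doubled 1+i<n o (subst (Linked _≢_) w≡qr (alt i 1+i<n)))
    where
    proj≡qqr : proj i (prependFirsts w) ≡ q ++ q ++ r
    proj≡qqr = trans (proj-++ i (firsts w) w) (cong₂ _++_ (proj-firsts-opening w w≡qr o) w≡qr)

  peel : ∃ λ a → w ∼ (firsts w ++ a)
  peel = pull-prefix (firsts w) w λ i →
    let (q , r , w≡qr , o) = proj-opening alt full i
    in r , trans w≡qr (cong (_++ r) (sym (proj-firsts-opening w w≡qr o)))

  -- Alternation forces the layer below firsts w to repeat its orientation on every edge.
  firsts-peeled : ∀ {a} → w ∼ (firsts w ++ a) → Alternating a → FullSupport a → firsts a ∼ firsts w
  firsts-peeled {a} w∼fa alt-a full-a = proj≡⇒∼ λ i →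
    let (q , r , w≡qr , o) = proj-opening alt full i
        (q′ , r′ , a≡q′r′ , o′) = proj-opening alt-a full-a i
        r≡a : r ≡ proj i a
        r≡a = ++-cancelˡ q r (proj i a) (trans (sym w≡qr) (trans (∼⇒proj≡ w∼fa i)
                (trans (proj-++ i (firsts w) a) (cong (_++ proj i a) (proj-firsts-opening w w≡qr o)))))
    in trans (proj-firsts-opening a a≡q′r′ o′)
         (trans (opening-repeats (subst (Opening n i q) (trans r≡a a≡q′r′) o) o′)
                (sym (proj-firsts-opening w w≡qr o)))

module _ {k : ℕ} (long : n * n < k) where

  prependFirsts-long : {a : Word n} → length a ≡ k → Alternating a →
                       length (prependFirsts a) ≡ k + n × Alternating (prependFirsts a)
  prependFirsts-long {a} len alt =
    trans (length-++ (firsts a)) (trans (cong₂ _+_ (length-firsts full) len) (ℕ.+-comm n k)) ,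
    prependFirsts-alternating alt full
    where
    full : FullSupport a
    full = long⇒fullSupport alt (subst (n * n <_) (sym len) long)

  prependFirsts-onto : {b : Word n} → length b ≡ k + n → Alternating b →
                       ∃ λ a → length a ≡ k × Alternating a × b ∼ prependFirsts a
  prependFirsts-onto {b} len alt = a , len-a , alt-a ,
      (b∼fa ◅◅ ∼-++ʳ a (∼-sym (firsts-peeled alt full b∼fa alt-a full-a)))
    where
    full : FullSupport b
    full = long⇒fullSupport alt (subst (n * n <_) (sym len) (ℕ.<-≤-trans long (ℕ.m≤m+n k n)))
    a : Word n
    a = proj₁ (peel alt full)
    b∼fa : b ∼ (firsts b ++ a)
    b∼fa = proj₂ (peel alt full)
    alt-a : Alternating a
    alt-a = alternating-++⁻ʳ (firsts b) (alternating-resp-∼ b∼fa alt)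
    len-a : length a ≡ k
    len-a = ℕ.+-cancelˡ-≡ n _ _ (begin
      n + length a                  ≡⟨ cong (_+ length a) (length-firsts full) ⟨
      length (firsts b) + length a  ≡⟨ length-++ (firsts b) ⟨
      length (firsts b ++ a)        ≡⟨ ∼-length b∼fa ⟨
      length b                      ≡⟨ trans len (ℕ.+-comm k n) ⟩
      n + k                         ∎)
      where open ≡-Reasoning
    full-a : FullSupport a
    full-a = long⇒fullSupport alt-a (subst (n * n <_) (sym len-a) long)

  heapCount-periodic : {hs hs′ : List (Word n)} → IsHeapEnum n k hs → IsHeapEnum n (k + n) hs′ →
                       length hs′ ≡ length hs
  heapCount-periodic {hs} {hs′} (hs-ok , hs-distinct , hs-complete) (hs′-ok , hs′-distinct , hs′-complete) =
    ℕ.≤-antisym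
      (length-≤-injection _∼_ (λ b a → b ∼ prependFirsts a) (λ b∼pa b′∼pa → b∼pa ◅◅ ∼-sym b′∼pa)
        hs′ hs hs′-distinct (All.map (λ {b} → lift-back {b}) hs′-ok))
      (length-≤-injection _∼_ (λ a b → prependFirsts a ∼ b)
        (λ {a} {a′} pa∼b pa′∼b → prependFirsts-reflects-∼ {w = a} {a′} (pa∼b ◅◅ ∼-sym pa′∼b))
        hs hs′ hs-distinct (All.map (λ {a} → push-forward {a}) hs-ok))
    where
    push-forward : ∀ {a} → length a ≡ k × Alternating a → Any (λ b → prependFirsts a ∼ b) hs′
    push-forward {a} (len , alt) =
      let (len′ , alt′) = prependFirsts-long {a} len alt in hs′-complete (prependFirsts a) len′ alt′
    lift-back : ∀ {b} → length b ≡ k + n × Alternating b → Any (λ a → b ∼ prependFirsts a) hs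
    lift-back {b} (len , alt) =
      let (a , len-a , alt-a , b∼pa) = prependFirsts-onto {b} len alt
      in Any.map (λ a∼a′ → b∼pa ◅◅ prependFirsts-resp-∼ a∼a′) (hs-complete a len-a alt-a)

corollary6p3 : (n : ℕ) → 1 ≤ n →
    ((k : ℕ) → ∃ (λ (hs : List (Word n)) → IsHeapEnum n k hs)) ×
    Σ ℕ (λ N → (k : ℕ) → N ≤ k → (hs hs' : List (Word n)) →
      IsHeapEnum n k hs → IsHeapEnum n (k + n) hs' → length hs' ≡ length hs)
corollary6p3 n _ =
  (λ k → heaps n k , heaps-isHeapEnum n k) ,
  (suc (n * n) , λ k long _ _ → heapCount-periodic long)
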